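{- Let $a,b$ be vertices of $\mathcal{G}_\infty$ with $a,b\notin 6\mathbb{N}_0$. If $a$ and $b$ are adjacent in $\mathcal{G}_\infty$, then $|a-b|=6$.
   Context: Let $\mathcal{P}$ be the set of odd primes and $\mathbb{N}_0=\{0,1,2,\dots\}$, so $6\mathbb{N}_0=\{0,6,12,\dots\}$. $\mathcal{G}_\infty$ is the simple undirected graph whose vertex set is the set of non-negative even integers, in which distinct $a,b$ are adjacent iff $\frac{a+b}{2}\in\mathcal{P}$ and $\frac{|a-b|}{2}\in\mathcal{P}$. -}

module Defs where

open import Data.Nat using (ℕ; _+_; ∣_-_∣; _/_)
open import Data.Nat.Primality using (Prime)
open import Data.Nat.Divisibility using (_∣_)
open import Data.Product using (_×_)
open import Relation.Binary.PropositionalEquality using (_≡_; _≢_)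

OddPrime : ℕ → Set
OddPrime p = Prime p × p ≢ 2

IsVertex : ℕ → Set
IsVertex a = 2 ∣ a

-- adjacency in 𝒢∞ (for even a, b the halvings below are exact)
Adjacent : ℕ → ℕ → Set
Adjacent a b = a ≢ b × OddPrime ((a + b) / 2) × OddPrime (∣ a - b ∣ / 2)

-- Write a = 2x and b = 2y, so the two primes are x + y and |x − y|. Neither x nor y is
-- divisible by 3, so their residues mod 3 are ±1 and 3 divides x + y or |x − y|; a prime
-- multiple of 3 is 3. If |x − y| = 3 we are done; if x + y = 3, then |x − y| is an odd
-- prime at most 3, hence again 3. Doubling gives |a − b| = 6.
module Submission where

open import Defs
open import Data.Nat using (ℕ; suc; ∣_-_∣; _+_; _*_; _/_; _≤_; s≤s)
open import Data.Nat.Properties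
  using (≤-trans; ∣m-n∣≤m⊔n; m⊔n≤m+n; ∣m+n-m+o∣≡∣n-o∣; *-distribʳ-∣-∣; *-distribʳ-+; +-comm)
open import Data.Nat.DivMod using (_divMod_; result; m*n/n≡m)
open import Data.Nat.Divisibility using (_∣_; divides; n∣m*n; *-monoˡ-∣)
open import Data.Nat.Primality using (Prime; prime⇒irreducible; prime⇒nonTrivial)
open import Data.Nat.Tactic.RingSolver using (solve-∀)
open import Data.Fin using (zero; suc)
open import Data.Product using (_,_; proj₁)
open import Data.Sum using (_⊎_; inj₁; inj₂)
open import Data.Empty using (⊥-elim)
open import Relation.Nullary using (¬_)
open import Relation.Binary.PropositionalEquality using (_≡_; refl; sym; cong; subst; module ≡-Reasoning)

private
  variable
    p x y : ℕ

prime-multiple-of-3⇒≡3 : Prime p → 3 ∣ p → p ≡ 3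
prime-multiple-of-3⇒≡3 prime-p 3∣p with prime⇒irreducible prime-p 3∣p
... | inj₁ ()
... | inj₂ 3≡p = sym 3≡p

oddPrime≤3⇒≡3 : OddPrime p → p ≤ 3 → p ≡ 3
oddPrime≤3⇒≡3 {0} (prime-p , _) _ with () ← prime⇒nonTrivial prime-p
oddPrime≤3⇒≡3 {1} (prime-p , _) _ with () ← prime⇒nonTrivial prime-p
oddPrime≤3⇒≡3 {2} (_ , p≢2) _ = ⊥-elim (p≢2 refl)
oddPrime≤3⇒≡3 {3} _ _ = refl
oddPrime≤3⇒≡3 {suc (suc (suc (suc _)))} _ (s≤s (s≤s (s≤s ())))

∣m-n∣≤m+n : ∀ m n → ∣ m - n ∣ ≤ m + n
∣m-n∣≤m+n m n = ≤-trans (∣m-n∣≤m⊔n m n) (m⊔n≤m+n m n)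

[m*2+n*2]/2≡m+n : ∀ m n → (m * 2 + n * 2) / 2 ≡ m + n
[m*2+n*2]/2≡m+n m n = subst (λ k → k / 2 ≡ m + n) (*-distribʳ-+ 2 m n) (m*n/n≡m (m + n) 2)

∣m*2-n*2∣/2≡∣m-n∣ : ∀ m n → ∣ m * 2 - n * 2 ∣ / 2 ≡ ∣ m - n ∣
∣m*2-n*2∣/2≡∣m-n∣ m n = subst (λ k → k / 2 ≡ ∣ m - n ∣) (*-distribʳ-∣-∣ 2 m n) (m*n/n≡m ∣ m - n ∣ 2)

3∣[1+q*3]+[2+s*3] : ∀ q s → 3 ∣ (1 + q * 3) + (2 + s * 3)
3∣[1+q*3]+[2+s*3] q s = divides (1 + q + s) (residues-sum q s)
  where
  residues-sum : ∀ q s → (1 + q * 3) + (2 + s * 3) ≡ (1 + q + s) * 3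
  residues-sum = solve-∀

3∣∣r+q*3-r+s*3∣ : ∀ r q s → 3 ∣ ∣ r + q * 3 - r + s * 3 ∣
3∣∣r+q*3-r+s*3∣ r q s = divides ∣ q - s ∣ (begin
  ∣ r + q * 3 - r + s * 3 ∣ ≡⟨ ∣m+n-m+o∣≡∣n-o∣ r (q * 3) (s * 3) ⟩
  ∣ q * 3 - s * 3 ∣         ≡⟨ *-distribʳ-∣-∣ 3 q s ⟨
  ∣ q - s ∣ * 3             ∎)
  where open ≡-Reasoning

3∤m⇒3∤n⇒3∣m+n⊎3∣∣m-n∣ : ¬ 3 ∣ x → ¬ 3 ∣ y → 3 ∣ x + y ⊎ 3 ∣ ∣ x - y ∣
3∤m⇒3∤n⇒3∣m+n⊎3∣∣m-n∣ {x} {y} 3∤x 3∤y with x divMod 3 | y divMod 3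
... | result q zero refl | _ = ⊥-elim (3∤x (n∣m*n q))
... | _ | result s zero refl = ⊥-elim (3∤y (n∣m*n s))
... | result q (suc zero) refl | result s (suc zero) refl = inj₂ (3∣∣r+q*3-r+s*3∣ 1 q s)
... | result q (suc (suc zero)) refl | result s (suc (suc zero)) refl = inj₂ (3∣∣r+q*3-r+s*3∣ 2 q s)
... | result q (suc zero) refl | result s (suc (suc zero)) refl =
  inj₁ (3∣[1+q*3]+[2+s*3] q s)
... | result q (suc (suc zero)) refl | result s (suc zero) refl =
  inj₁ (subst (3 ∣_) (+-comm (1 + s * 3) (2 + q * 3)) (3∣[1+q*3]+[2+s*3] s q))

oddPrime-sum-and-difference⇒∣m-n∣≡3 :
  ¬ 3 ∣ x → ¬ 3 ∣ y → OddPrime (x + y) → OddPrime ∣ x - y ∣ → ∣ x - y ∣ ≡ 3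
oddPrime-sum-and-difference⇒∣m-n∣≡3 {x} {y} 3∤x 3∤y (prime-sum , _) odd-prime-diff
  with 3∤m⇒3∤n⇒3∣m+n⊎3∣∣m-n∣ 3∤x 3∤y
... | inj₁ 3∣sum = oddPrime≤3⇒≡3 odd-prime-diff
      (subst (∣ x - y ∣ ≤_) (prime-multiple-of-3⇒≡3 prime-sum 3∣sum) (∣m-n∣≤m+n x y))
... | inj₂ 3∣diff = prime-multiple-of-3⇒≡3 (proj₁ odd-prime-diff) 3∣diff

mainTheorem11 : (a b : ℕ) → IsVertex a → IsVertex b → ¬ (6 ∣ a) → ¬ (6 ∣ b) →
                  Adjacent a b → ∣ a - b ∣ ≡ 6
mainTheorem11 .(x * 2) .(y * 2) (divides x refl) (divides y refl) 6∤a 6∤b (_ , sum-prime , diff-prime) =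
  begin
    ∣ x * 2 - y * 2 ∣ ≡⟨ *-distribʳ-∣-∣ 2 x y ⟨
    ∣ x - y ∣ * 2     ≡⟨ cong (_* 2) ∣x-y∣≡3 ⟩
    6                 ∎
  where
  open ≡-Reasoning
  ∣x-y∣≡3 : ∣ x - y ∣ ≡ 3
  ∣x-y∣≡3 = oddPrime-sum-and-difference⇒∣m-n∣≡3 {x} {y}
    (λ 3∣x → 6∤a (*-monoˡ-∣ 2 3∣x)) (λ 3∣y → 6∤b (*-monoˡ-∣ 2 3∣y))
    (subst OddPrime ([m*2+n*2]/2≡m+n x y) sum-prime)
    (subst OddPrime (∣m*2-n*2∣/2≡∣m-n∣ x y) diff-prime)
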